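{- Let $p$ be the partially ordered pattern of length $4$ on the labels $\{1,2,3,4\}$ whose only relations are $2>1$ and $2>4$ (label $3$ is incomparable to all others, and $1,4$ are incomparable). Let $a(n)$ be the number of $n$-permutations avoiding $p$. Then $a(0)=a(1)=1$, $a(2)=2$, $a(3)=6$, and for $n\geq 4$, $a(n)=3a(n-1)-a(n-2)$. Also, $$\sum_{n\geq 0}a(n)x^n=\frac{1-2x+x^3}{1-3x+x^2}.$$
   Context: An $n$-permutation is a permutation $\pi=\pi_1\cdots\pi_n$ of $\{1,\dots,n\}$ written in one-line notation (for $n=0$ there is exactly one, the empty permutation). A partially ordered pattern (POP) $p$ of length $k$ is a partial order $<_P$ on the label set $\{1,\dots,k\}$. An occurrence of $p$ in $\pi$ is a subsequence $\pi_{i_1}\pi_{i_2}\cdots\pi_{i_k}$ with $1\leq i_1<\cdots<i_k\leq n$ such that $\pi_{i_j}<\pi_{i_m}$ whenever $j<_P m$ (no condition is imposed on pairs of incomparable labels). A permutation avoids $p$ if it contains no occurrence of $p$. -}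

module Defs where

open import Data.Nat using (ℕ; zero; suc)
open import Data.Fin using (Fin) renaming (_<_ to _<ᶠ_)
open import Data.Fin.Properties using (any?; all?; _≟_) renaming (_<?_ to _<ᶠ?_)
open import Data.Vec using (Vec; []; _∷_; lookup)
open import Data.List using (List; []; _∷_; concatMap; map; filter; length)
open import Data.Product using (Σ; ∃; _×_; _,_)
open import Data.Integer using (ℤ; +_; -[1+_]) renaming (_+_ to _+ℤ_; _*_ to _*ℤ_)
open import Relation.Nullary using (¬_; Dec)
open import Relation.Nullary.Decidable using (_×-dec_; _→-dec_; ¬?)
open import Relation.Unary using (Decidable)
open import Relation.Binary.PropositionalEquality using (_≡_)

-- An n-permutation in one-line notation: a vector π = π₁⋯πₙ of values in
-- {0,…,n-1} (= Fin n, i.e. {1,…,n} shifted by one) that is injective.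
IsPerm : ∀ {n} → Vec (Fin n) n → Set
IsPerm π = ∀ i j → lookup π i ≡ lookup π j → i ≡ j

Occurrence : ∀ {n} → Vec (Fin n) n → Fin n → Fin n → Fin n → Fin n → Set
Occurrence π i₁ i₂ i₃ i₄ =
  (i₁ <ᶠ i₂) × (i₂ <ᶠ i₃) × (i₃ <ᶠ i₄) ×
  (lookup π i₁ <ᶠ lookup π i₂) × (lookup π i₄ <ᶠ lookup π i₂)

Contains : ∀ {n} → Vec (Fin n) n → Set
Contains π = ∃ λ i₁ → ∃ λ i₂ → ∃ λ i₃ → ∃ λ i₄ → Occurrence π i₁ i₂ i₃ i₄

Avoids : ∀ {n} → Vec (Fin n) n → Set
Avoids π = ¬ Contains π

isPerm? : ∀ {n} → Decidable (IsPerm {n})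
isPerm? π = all? λ i → all? λ j → (lookup π i ≟ lookup π j) →-dec (i ≟ j)

contains? : ∀ {n} → Decidable (Contains {n})
contains? π = any? λ i₁ → any? λ i₂ → any? λ i₃ → any? λ i₄ →
  (i₁ <ᶠ? i₂) ×-dec (i₂ <ᶠ? i₃) ×-dec (i₃ <ᶠ? i₄) ×-dec
  (lookup π i₁ <ᶠ? lookup π i₂) ×-dec (lookup π i₄ <ᶠ? lookup π i₂)

allFinL : ∀ n → List (Fin n)
allFinL zero = []
allFinL (suc n) = Fin.zero ∷ map Fin.suc (allFinL n)

allVecs : ∀ k n → List (Vec (Fin n) k)
allVecs zero n = [] ∷ []
allVecs (suc k) n = concatMap (λ x → map (x ∷_) (allVecs k n)) (allFinL n)

a : ℕ → ℕ
a n = length (filter (λ π → isPerm? π ×-dec ¬? (contains? π)) (allVecs n n))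

PS : Set
PS = ℕ → ℤ

sumTo : ℕ → (ℕ → ℤ) → ℤ
sumTo zero f = f zero
sumTo (suc n) f = sumTo n f +ℤ f (suc n)

_∸'_ : ℕ → ℕ → ℕ
m ∸' zero = m
zero ∸' suc k = zero
suc m ∸' suc k = m ∸' k

_·_ : PS → PS → PS
(f · g) n = sumTo n (λ i → f i *ℤ g (n ∸' i))

A : PS
A n = + (a n)

den : PS
den 0 = + 1
den 1 = -[1+ 2 ]
den 2 = + 1
den _ = + 0

num : PS
num 0 = + 1
num 1 = -[1+ 1 ]
num 2 = + 0
num 3 = + 1
num _ = + 0

module Submission where

-- Classify a permutation by the position of its largest entry.  A maximum with an entry before
-- it and two entries after it is label 2 of an occurrence, so in an avoider of length n + 1 it
-- stands first, second-to-last or last.  First or last it can play no label, so deleting it is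
-- a bijection onto the avoiders of length n.  Second-to-last it can only play label 3, which
-- happens exactly when the rest σ has a peak before its last entry: i < j < last with
-- σ(i) < σ(j) > σ(last).  If b(n) and c(n) count the avoiders without and with such a peak,
-- this gives a(n+1) = 2a(n) + b(n).  A maximum in front keeps the peak status, one in
-- second-to-last position creates a peak and one at the end rules it out, so for n ≥ 2 also
-- c(n+1) = c(n) + b(n) = a(n).  As a = b + c, eliminating b and c leaves
-- a(n+2) = 3a(n+1) - a(n), which is the generating-function identity coefficient by coefficient.

open import Defs
open import Level using (Level; 0ℓ)
open import Data.Nat using (ℕ; zero; suc; _+_; _*_; z<s; s<s; s<s⁻¹) renaming (_<_ to _<ℕ_)
import Data.Nat.Properties as ℕ
open import Data.Nat.ListAction using (sum)
open import Data.Nat.Tactic.RingSolver using (solve)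
open import Data.Integer using (ℤ; +_; -[1+_]; _-_) renaming (_+_ to _+ℤ_; _*_ to _*ℤ_)
open import Data.Integer.Properties using (pos-+; pos-*; +-inverseʳ) renaming (+-identityʳ to +ℤ-identityʳ)
open import Data.Integer.Tactic.RingSolver using (solve-∀)
open import Data.Fin using (Fin; zero; suc; inject₁; fromℕ; punchIn; punchOut; pinch; _<_)
open import Data.Fin.Permutation using (↔⇒≡)
open import Data.Fin.Properties using (_≟_; _<?_; +↔⊎; any?; ≤-refl; <-trans; <-irrefl; <⇒≢; ≤∧≢⇒<;
  ≤fromℕ; fromℕ≢inject₁; inject₁-injective; toℕ-inject₁; ≤̄⇒inject₁<; injective⇒≤;
  punchIn-mono-≤; punchIn-cancel-≤; punchIn-punchOut; punchIn-injective; punchInᵢ≢i; punchOut-injective)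
open import Data.Vec using (Vec; []; _∷_; lookup; insertAt; removeAt) renaming (map to mapᵥ)
open import Data.Vec.Properties using (insertAt-lookup; insertAt-punchIn; insertAt-removeAt;
  removeAt-insertAt; lookup-map) renaming (map-∘ to mapᵥ-∘; map-cong to mapᵥ-cong; map-id to mapᵥ-id)
open import Data.List as List using (List; []; _∷_; _++_; map; filter; length; concatMap)
open import Data.List.Properties using (filter-++; length-++; map-∘; map-cong)
open import Data.Product using (Σ; ∃; _×_; _,_; proj₁; proj₂)
open import Data.Product.Function.Dependent.Propositional using (Σ-↔)
open import Data.Sum using (_⊎_; inj₁; inj₂; [_,_])
open import Data.Sum.Algebra using (⊎-assoc)
open import Data.Sum.Function.Propositional using (_⊎-↔_)
open import Data.Bool using (true; false)
open import Data.Bool.Properties using (T-irrelevant)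
open import Data.Empty using (⊥-elim)
open import Function using (_∘_; id; _↔_; mk↔ₛ′)
open import Function.Properties.Inverse using (↔-refl; ↔-sym; ↔-trans)
open import Relation.Nullary using (¬_; yes; no; does; contradiction)
open import Relation.Nullary.Decidable using (True; fromWitness; toWitness; _×-dec_)
open import Relation.Unary using (Pred; Decidable; _⊆_; _≐_; _∩_; ∁)
open import Relation.Unary.Properties using (_∩?_; ∁?)
open import Relation.Binary.PropositionalEquality hiding ([_])

private variable
  ℓ ℓ′ : Level
  X Y : Set
  k m n : ℕ

-- Counting vectors that satisfy a decidable predicate

Satisfying : {P : Pred X ℓ} → Decidable P → Set
Satisfying {X = X} P? = Σ X (True ∘ P?)

Satisfying-≡ : {P : Pred X ℓ} {P? : Decidable P} {x y : X} (s : True (P? x)) (t : True (P? y)) →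
  x ≡ y → _≡_ {A = Satisfying P?} (x , s) (y , t)
Satisfying-≡ s t refl = cong (_ ,_) (T-irrelevant s t)

Satisfying-cong : {P : Pred X ℓ} {Q : Pred X ℓ′} {P? : Decidable P} {Q? : Decidable Q} →
  P ≐ Q → Satisfying P? ↔ Satisfying Q?
Satisfying-cong (P⊆Q , Q⊆P) = mk↔ₛ′
  (λ (x , t) → x , fromWitness (P⊆Q (toWitness t)))
  (λ (x , t) → x , fromWitness (Q⊆P (toWitness t)))
  (λ (x , t) → Satisfying-≡ _ t refl)
  (λ (x , t) → Satisfying-≡ _ t refl)

Satisfying-∅↔ : {P : Pred X ℓ} {P? : Decidable P} → (∀ x → ¬ P x) → Satisfying P? ↔ Fin 0
Satisfying-∅↔ ∅ = mk↔ₛ′ (λ (x , t) → ⊥-elim (∅ x (toWitness t))) (λ ()) (λ ())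
  (λ (x , t) → ⊥-elim (∅ x (toWitness t)))

Satisfying-∷↔ : {P : Pred (Vec X (suc k)) ℓ} (P? : Decidable P) →
  Satisfying P? ↔ Σ X (λ x → Satisfying (P? ∘ (x ∷_)))
Satisfying-∷↔ P? = mk↔ₛ′
  (λ { (x ∷ v , t) → x , v , t })
  (λ { (x , v , t) → x ∷ v , t })
  (λ _ → refl)
  (λ { (x ∷ v , t) → refl })

#_ : {P : Pred (Vec (Fin n) k) ℓ} → Decidable P → ℕ
#_ {n = n} {k = k} P? = length (filter P? (allVecs k n))

length-filter-map : {P : Pred Y ℓ} (P? : Decidable P) (f : X → Y) (xs : List X) →
  length (filter P? (map f xs)) ≡ length (filter (P? ∘ f) xs)
length-filter-map P? f [] = refl
length-filter-map P? f (x ∷ xs) with does (P? (f x))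
... | true = cong suc (length-filter-map P? f xs)
... | false = length-filter-map P? f xs

length-filter-concatMap : {P : Pred Y ℓ} (P? : Decidable P) (f : X → List Y) (xs : List X) →
  length (filter P? (concatMap f xs)) ≡ sum (map (length ∘ filter P? ∘ f) xs)
length-filter-concatMap P? f [] = refl
length-filter-concatMap P? f (x ∷ xs) = begin
  length (filter P? (f x ++ concatMap f xs))
    ≡⟨ cong length (filter-++ P? (f x) _) ⟩
  length (filter P? (f x) ++ filter P? (concatMap f xs))
    ≡⟨ length-++ (filter P? (f x)) ⟩
  length (filter P? (f x)) + length (filter P? (concatMap f xs))
    ≡⟨ cong (λ r → length (filter P? (f x)) + r) (length-filter-concatMap P? f xs) ⟩
  sum (map (length ∘ filter P? ∘ f) (x ∷ xs))
    ∎
  where open ≡-Reasoning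

length-filter-split : {P : Pred X ℓ} {Q : Pred X ℓ′} (P? : Decidable P) (Q? : Decidable Q) (xs : List X) →
  length (filter P? xs) ≡ length (filter (P? ∩? ∁? Q?) xs) + length (filter (P? ∩? Q?) xs)
length-filter-split P? Q? [] = refl
length-filter-split P? Q? (x ∷ xs) with does (P? x) | does (Q? x)
... | true | true = trans (cong suc (length-filter-split P? Q? xs)) (sym (ℕ.+-suc _ _))
... | true | false = cong suc (length-filter-split P? Q? xs)
... | false | _ = length-filter-split P? Q? xs

#-∷ : {P : Pred (Vec (Fin n) (suc k)) ℓ} (P? : Decidable P) →
  # P? ≡ sum (map (λ x → # (P? ∘ (x ∷_))) (allFinL n))
#-∷ {n = n} {k = k} P? =
  trans (length-filter-concatMap P? (λ x → map (x ∷_) (allVecs k n)) (allFinL n))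
        (cong sum (map-cong (λ x → length-filter-map P? (x ∷_) (allVecs k n)) (allFinL n)))

Fin-cong : m ≡ n → Fin m ↔ Fin n
Fin-cong refl = ↔-refl

⊎-Fin↔ : {A B : Set} → A ↔ Fin m → B ↔ Fin n → (A ⊎ B) ↔ Fin (m + n)
⊎-Fin↔ A↔ B↔ = ↔-trans (A↔ ⊎-↔ B↔) (↔-sym +↔⊎)

⊎-identityˡ-∅ : {A B : Set} → ¬ A → (A ⊎ B) ↔ B
⊎-identityˡ-∅ ¬a =
  mk↔ₛ′ [ ⊥-elim ∘ ¬a , id ] inj₂ (λ _ → refl) [ ⊥-elim ∘ ¬a , (λ _ → refl) ]

Σ-Fin-suc↔ : (B : Fin (suc n) → Set) → Σ (Fin (suc n)) B ↔ (B zero ⊎ Σ (Fin n) (B ∘ suc))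
Σ-Fin-suc↔ B = mk↔ₛ′
  (λ { (zero , b) → inj₁ b ; (suc i , b) → inj₂ (i , b) })
  (λ { (inj₁ b) → zero , b ; (inj₂ (i , b)) → suc i , b })
  (λ { (inj₁ b) → refl ; (inj₂ (i , b)) → refl })
  (λ { (zero , b) → refl ; (suc i , b) → refl })

Σ-Fin-fromℕ↔ : (B : Fin (suc n) → Set) →
  Σ (Fin (suc n)) B ↔ (Σ (Fin n) (B ∘ inject₁) ⊎ B (fromℕ n))
Σ-Fin-fromℕ↔ {n = zero} B = mk↔ₛ′
  (λ { (zero , b) → inj₂ b })
  (λ { (inj₂ b) → zero , b })
  (λ { (inj₂ b) → refl })
  (λ { (zero , b) → refl })
Σ-Fin-fromℕ↔ {n = suc n} B =
  ↔-trans (Σ-Fin-suc↔ B) (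
  ↔-trans (↔-refl ⊎-↔ Σ-Fin-fromℕ↔ (B ∘ suc)) (
  ↔-trans (↔-sym (⊎-assoc _ _ _ _))
          (↔-sym (Σ-Fin-suc↔ (B ∘ inject₁)) ⊎-↔ ↔-refl)))

-- suc (inject₁ (inject₁ j)) runs through the inner positions 1, …, J of Fin (3 + J).
Σ-Fin-ends↔ : ∀ {J} (B : Fin (suc (suc (suc J))) → Set) →
  (∀ j → ¬ B (suc (inject₁ (inject₁ j)))) →
  Σ (Fin (suc (suc (suc J)))) B ↔ (B zero ⊎ B (inject₁ (fromℕ (suc J))) ⊎ B (fromℕ (suc (suc J))))
Σ-Fin-ends↔ B inner-empty =
  ↔-trans (Σ-Fin-suc↔ B) (↔-refl ⊎-↔
  ↔-trans (Σ-Fin-fromℕ↔ (B ∘ suc))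
          (↔-trans (Σ-Fin-fromℕ↔ (B ∘ suc ∘ inject₁)) (⊎-identityˡ-∅ (λ (j , b) → inner-empty j b))
           ⊎-↔ ↔-refl))

Σ-Fin↔sum : (c : Fin n → ℕ) → Σ (Fin n) (Fin ∘ c) ↔ Fin (sum (map c (allFinL n)))
Σ-Fin↔sum {n = zero} c = mk↔ₛ′ (λ { (() , _) }) (λ ()) (λ ()) (λ { (() , _) })
Σ-Fin↔sum {n = suc n} c =
  ↔-trans (Σ-Fin-suc↔ (Fin ∘ c)) (
  ↔-trans (↔-refl ⊎-↔ Σ-Fin↔sum (c ∘ suc)) (
  ↔-trans (↔-sym +↔⊎) (Fin-cong (cong (λ xs → c zero + sum xs) (map-∘ (allFinL n))))))

Satisfying↔Fin# : {P : Pred (Vec (Fin n) k) ℓ} (P? : Decidable P) → Satisfying P? ↔ Fin (# P?)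
Satisfying↔Fin# {k = zero} P? with P? []
... | yes p = mk↔ₛ′ (λ _ → zero) (λ _ → [] , fromWitness p) (λ { zero → refl })
                    (λ { ([] , t) → Satisfying-≡ _ t refl })
... | no ¬p = mk↔ₛ′ (λ { ([] , t) → ⊥-elim (¬p (toWitness t)) }) (λ ()) (λ ())
                    (λ { ([] , t) → ⊥-elim (¬p (toWitness t)) })
Satisfying↔Fin# {k = suc k} P? =
  ↔-trans (Satisfying-∷↔ P?) (
  ↔-trans (Σ-↔ ↔-refl (Satisfying↔Fin# (P? ∘ (_ ∷_)))) (
  ↔-trans (Σ-Fin↔sum (λ x → # (P? ∘ (x ∷_)))) (Fin-cong (sym (#-∷ P?)))))

Satisfying≐↔Fin# : {P : Pred (Vec (Fin n) k) ℓ} {Q : Pred (Vec (Fin n) k) ℓ′}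
  (P? : Decidable P) (Q? : Decidable Q) → P ≐ Q → Satisfying P? ↔ Fin (# Q?)
Satisfying≐↔Fin# P? Q? P≐Q = ↔-trans (Satisfying-cong P≐Q) (Satisfying↔Fin# Q?)

punchIn-mono-< : ∀ (q : Fin (suc n)) {j k} → j < k → punchIn q j < punchIn q k
punchIn-mono-< q {j} {k} j<k = ℕ.≰⇒> (ℕ.<⇒≱ j<k ∘ punchIn-cancel-≤ q k j)

punchIn-cancel-< : ∀ (q : Fin (suc n)) {j k} → punchIn q j < punchIn q k → j < k
punchIn-cancel-< q {j} {k} lt = ℕ.≰⇒> (ℕ.<⇒≱ lt ∘ punchIn-mono-≤ q k j)

inject₁-mono-< : {x y : Fin n} → x < y → inject₁ x < inject₁ y
inject₁-mono-< {x = x} {y} = subst₂ _<ℕ_ (sym (toℕ-inject₁ x)) (sym (toℕ-inject₁ y))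

inject₁-cancel-< : {x y : Fin n} → inject₁ x < inject₁ y → x < y
inject₁-cancel-< {x = x} {y} = subst₂ _<ℕ_ (toℕ-inject₁ x) (toℕ-inject₁ y)

inject₁<fromℕ : ∀ (x : Fin n) → inject₁ x < fromℕ n
inject₁<fromℕ x = ≤∧≢⇒< (≤fromℕ (inject₁ x)) (fromℕ≢inject₁ ∘ sym)

fromℕ≮ : ∀ (i : Fin (suc n)) → ¬ fromℕ n < i
fromℕ≮ i lt = ℕ.<⇒≱ lt (≤fromℕ i)

secondLast : ∀ {n} → Fin (suc (suc n))
secondLast {n} = inject₁ (fromℕ n)

secondLast<⇒≡fromℕ : ∀ (i : Fin (suc (suc n))) → secondLast {n} < i → i ≡ fromℕ (suc n)
secondLast<⇒≡fromℕ {n = zero} (suc zero) _ = refl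
secondLast<⇒≡fromℕ {n = suc n} (suc i) lt = cong suc (secondLast<⇒≡fromℕ i (s<s⁻¹ lt))

punchIn-secondLast-fromℕ : punchIn secondLast (fromℕ n) ≡ fromℕ (suc n)
punchIn-secondLast-fromℕ {n = zero} = refl
punchIn-secondLast-fromℕ {n = suc n} = cong suc punchIn-secondLast-fromℕ

punchIn-inject₁-< : ∀ {i j : Fin n} → j < i → punchIn (inject₁ i) j < inject₁ i
punchIn-inject₁-< {i = suc i} {zero} _ = z<s
punchIn-inject₁-< {i = suc i} {suc j} lt = s<s (punchIn-inject₁-< (s<s⁻¹ lt))

data PunchInView (q : Fin (suc n)) : Fin (suc n) → Set where
  at    : PunchInView q q
  punch : ∀ j → PunchInView q (punchIn q j)

punchInView : (q i : Fin (suc n)) → PunchInView q i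
punchInView q i with q ≟ i
... | yes refl = at
... | no q≢i = subst (PunchInView q) (punchIn-punchOut q≢i) (punch (punchOut q≢i))

injective⇒surjective : (f : Fin n → Fin n) → (∀ i j → f i ≡ f j → i ≡ j) →
  ∀ y → ∃ λ x → f x ≡ y
injective⇒surjective {n = zero} f f-inj ()
injective⇒surjective {n = suc n} f f-inj y with any? (λ x → f x ≟ y)
... | yes hit = hit
... | no miss = contradiction (injective⇒≤ g-injective) ℕ.1+n≰n
  where
  y≢f : ∀ x → y ≢ f x
  y≢f x y≡fx = miss (x , sym y≡fx)
  g : Fin (suc n) → Fin n
  g x = punchOut (y≢f x)
  g-injective : ∀ {x x′} → g x ≡ g x′ → x ≡ x′
  g-injective {x} {x′} e = f-inj x x′ (punchOut-injective (y≢f x) (y≢f x′) e)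

pinch-fromℕ-inject₁ : ∀ (x : Fin (suc m)) → pinch (fromℕ m) (inject₁ x) ≡ x
pinch-fromℕ-inject₁ {m = zero} zero = refl
pinch-fromℕ-inject₁ {m = suc m} zero = refl
pinch-fromℕ-inject₁ {m = suc m} (suc x) = cong suc (pinch-fromℕ-inject₁ x)

inject₁-pinch-fromℕ : ∀ (x : Fin (suc (suc m))) → x ≢ fromℕ (suc m) →
  inject₁ (pinch (fromℕ m) x) ≡ x
inject₁-pinch-fromℕ {m = zero} zero _ = refl
inject₁-pinch-fromℕ {m = zero} (suc zero) x≢max = contradiction refl x≢max
inject₁-pinch-fromℕ {m = suc m} zero _ = refl
inject₁-pinch-fromℕ {m = suc m} (suc x) x≢max = cong suc (inject₁-pinch-fromℕ x (x≢max ∘ cong suc))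

map-inject₁∘pinch-fromℕ : (w : Vec (Fin (suc (suc m))) n) → (∀ j → lookup w j ≢ fromℕ (suc m)) →
  mapᵥ inject₁ (mapᵥ (pinch (fromℕ m)) w) ≡ w
map-inject₁∘pinch-fromℕ [] _ = refl
map-inject₁∘pinch-fromℕ (x ∷ w) w≢max =
  cong₂ _∷_ (inject₁-pinch-fromℕ x (w≢max zero)) (map-inject₁∘pinch-fromℕ w (w≢max ∘ suc))

lookup-removeAt : ∀ {A : Set} (xs : Vec A (suc n)) q j → lookup (removeAt xs q) j ≡ lookup xs (punchIn q j)
lookup-removeAt xs q j = begin
  lookup (removeAt xs q) j
    ≡⟨ insertAt-punchIn (removeAt xs q) q (lookup xs q) j ⟨
  lookup (insertAt (removeAt xs q) q (lookup xs q)) (punchIn q j)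
    ≡⟨ cong (λ v → lookup v (punchIn q j)) (insertAt-removeAt xs q) ⟩
  lookup xs (punchIn q j)
    ∎
  where open ≡-Reasoning

-- Inserting a new maximum

insertMax : Fin (suc n) → Vec (Fin m) n → Vec (Fin (suc m)) (suc n)
insertMax {m = m} q σ = insertAt (mapᵥ inject₁ σ) q (fromℕ m)

module _ (q : Fin (suc n)) (σ : Vec (Fin m) n) where

  lookup-insertMax-max : lookup (insertMax q σ) q ≡ fromℕ m
  lookup-insertMax-max = insertAt-lookup (mapᵥ inject₁ σ) q (fromℕ m)

  lookup-insertMax-punchIn : ∀ j → lookup (insertMax q σ) (punchIn q j) ≡ inject₁ (lookup σ j)
  lookup-insertMax-punchIn j =
    trans (insertAt-punchIn (mapᵥ inject₁ σ) q (fromℕ m) j) (lookup-map j inject₁ σ)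

  insertMax-≮-max : ∀ i → ¬ (lookup (insertMax q σ) q < lookup (insertMax q σ) i)
  insertMax-≮-max i lt = fromℕ≮ _ (subst (_< lookup (insertMax q σ) i) lookup-insertMax-max lt)

  insertMax-<-max : ∀ {i} → q ≢ i → lookup (insertMax q σ) i < lookup (insertMax q σ) q
  insertMax-<-max {i} q≢i with punchInView q i
  ... | at = contradiction refl q≢i
  ... | punch j = subst₂ _<_ (sym (lookup-insertMax-punchIn j)) (sym lookup-insertMax-max)
                    (inject₁<fromℕ (lookup σ j))

  insertMax-mono-< : ∀ {j k} → lookup σ j < lookup σ k →
    lookup (insertMax q σ) (punchIn q j) < lookup (insertMax q σ) (punchIn q k)
  insertMax-mono-< {j} {k} lt =
    subst₂ _<_ (sym (lookup-insertMax-punchIn j)) (sym (lookup-insertMax-punchIn k)) (inject₁-mono-< lt)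

  insertMax-cancel-< : ∀ {j k} →
    lookup (insertMax q σ) (punchIn q j) < lookup (insertMax q σ) (punchIn q k) → lookup σ j < lookup σ k
  insertMax-cancel-< {j} {k} lt =
    inject₁-cancel-< (subst₂ _<_ (lookup-insertMax-punchIn j) (lookup-insertMax-punchIn k) lt)

module _ (q : Fin (suc n)) (σ : Vec (Fin n) n) where

  isPerm-insertMax : IsPerm σ → IsPerm (insertMax q σ)
  isPerm-insertMax σ-inj i j e with punchInView q i | punchInView q j
  ... | at | at = refl
  ... | at | punch j′ = ⊥-elim (fromℕ≢inject₁
    (trans (sym (lookup-insertMax-max q σ)) (trans e (lookup-insertMax-punchIn q σ j′))))
  ... | punch i′ | at = ⊥-elim (fromℕ≢inject₁
    (trans (sym (lookup-insertMax-max q σ)) (trans (sym e) (lookup-insertMax-punchIn q σ i′))))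
  ... | punch i′ | punch j′ = cong (punchIn q) (σ-inj i′ j′ (inject₁-injective
    (trans (sym (lookup-insertMax-punchIn q σ i′)) (trans e (lookup-insertMax-punchIn q σ j′)))))

  isPerm-insertMax⁻ : IsPerm (insertMax q σ) → IsPerm σ
  isPerm-insertMax⁻ π-inj i j e = punchIn-injective q i j (π-inj _ _
    (trans (lookup-insertMax-punchIn q σ i) (trans (cong inject₁ e) (sym (lookup-insertMax-punchIn q σ j)))))

removeMax : Fin (suc n) → Vec (Fin (suc (suc m))) (suc n) → Vec (Fin (suc m)) n
removeMax {m = m} q π = mapᵥ (pinch (fromℕ m)) (removeAt π q)

removeMax-insertMax : (q : Fin (suc n)) (σ : Vec (Fin (suc m)) n) → removeMax q (insertMax q σ) ≡ σ
removeMax-insertMax {m = m} q σ = begin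
  mapᵥ (pinch (fromℕ m)) (removeAt (insertAt (mapᵥ inject₁ σ) q (fromℕ (suc m))) q)
    ≡⟨ cong (mapᵥ (pinch (fromℕ m))) (removeAt-insertAt (mapᵥ inject₁ σ) q _) ⟩
  mapᵥ (pinch (fromℕ m)) (mapᵥ inject₁ σ) ≡⟨ mapᵥ-∘ (pinch (fromℕ m)) inject₁ σ ⟨
  mapᵥ (pinch (fromℕ m) ∘ inject₁) σ     ≡⟨ mapᵥ-cong pinch-fromℕ-inject₁ σ ⟩
  mapᵥ id σ                              ≡⟨ mapᵥ-id σ ⟩
  σ                                      ∎
  where open ≡-Reasoning

insertMax-removeMax : (q : Fin (suc (suc m))) (π : Vec (Fin (suc (suc m))) (suc (suc m))) →
  IsPerm π → lookup π q ≡ fromℕ (suc m) → insertMax q (removeMax q π) ≡ π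
insertMax-removeMax {m = m} q π π-inj πq≡max = begin
  insertAt (mapᵥ inject₁ (mapᵥ (pinch (fromℕ m)) (removeAt π q))) q (fromℕ (suc m))
    ≡⟨ cong (λ w → insertAt w q (fromℕ (suc m)))
            (map-inject₁∘pinch-fromℕ (removeAt π q) rest≢max) ⟩
  insertAt (removeAt π q) q (fromℕ (suc m)) ≡⟨ cong (insertAt (removeAt π q) q) πq≡max ⟨
  insertAt (removeAt π q) q (lookup π q)    ≡⟨ insertAt-removeAt π q ⟩
  π                                         ∎
  where
  open ≡-Reasoning
  rest≢max : ∀ j → lookup (removeAt π q) j ≢ fromℕ (suc m)
  rest≢max j e = punchInᵢ≢i q j (π-inj _ _ (trans (sym (lookup-removeAt π q j)) (trans e (sym πq≡max))))

module _ {P : Pred (Vec (Fin (suc (suc m))) (suc (suc m))) ℓ} (P? : Decidable P) (P⊆IsPerm : P ⊆ IsPerm) where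

  private
    ByMaxPosition : Set
    ByMaxPosition = Σ (Fin (suc (suc m))) λ q → Satisfying (P? ∘ insertMax q)

    maxPosition : ∀ π → IsPerm π → ∃ λ q → lookup π q ≡ fromℕ (suc m)
    maxPosition π perm = injective⇒surjective (lookup π) perm (fromℕ (suc m))

    ByMaxPosition-≡ : ∀ {q q′ σ σ′}
      {t : True (P? (insertMax q σ))} {t′ : True (P? (insertMax q′ σ′))} →
      q ≡ q′ → σ ≡ σ′ → _≡_ {A = ByMaxPosition} (q , σ , t) (q′ , σ′ , t′)
    ByMaxPosition-≡ {q} {σ = σ} refl refl = cong (λ t → q , σ , t) (T-irrelevant _ _)

  Satisfying-insertMax↔ : Satisfying P? ↔ ByMaxPosition
  Satisfying-insertMax↔ = mk↔ₛ′ to from to∘from from∘to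
    where
    to : Satisfying P? → ByMaxPosition
    to (π , t) =
      let perm = P⊆IsPerm (toWitness t); (q , πq≡max) = maxPosition π perm in
      q , removeMax q π , subst (True ∘ P?) (sym (insertMax-removeMax q π perm πq≡max)) t
    from : ByMaxPosition → Satisfying P?
    from (q , σ , t) = insertMax q σ , t
    to∘from : ∀ y → to (from y) ≡ y
    to∘from (q , σ , t) =
      ByMaxPosition-≡ q′≡q
        (trans (cong (λ q′ → removeMax q′ (insertMax q σ)) q′≡q) (removeMax-insertMax q σ))
      where
      perm = P⊆IsPerm (toWitness t)
      q′≡q = perm _ q (trans (proj₂ (maxPosition (insertMax q σ) perm)) (sym (lookup-insertMax-max q σ)))
    from∘to : ∀ x → from (to x) ≡ x
    from∘to (π , t) = Satisfying-≡ {P? = P?} _ t (insertMax-removeMax _ π perm (proj₂ (maxPosition π perm)))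
      where perm = P⊆IsPerm (toWitness t)

-- Occurrences through an inserted maximum

module _ (q : Fin (suc n)) (σ : Vec (Fin n) n) where

  Occurrence-insertMax⁺ : ∀ {j₁ j₂ j₃ j₄} → Occurrence σ j₁ j₂ j₃ j₄ →
    Occurrence (insertMax q σ) (punchIn q j₁) (punchIn q j₂) (punchIn q j₃) (punchIn q j₄)
  Occurrence-insertMax⁺ (l₁₂ , l₂₃ , l₃₄ , v₁₂ , v₄₂) =
    punchIn-mono-< q l₁₂ , punchIn-mono-< q l₂₃ , punchIn-mono-< q l₃₄ ,
    insertMax-mono-< q σ v₁₂ , insertMax-mono-< q σ v₄₂

  Occurrence-insertMax⁻ : ∀ {j₁ j₂ j₃ j₄} →
    Occurrence (insertMax q σ) (punchIn q j₁) (punchIn q j₂) (punchIn q j₃) (punchIn q j₄) →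
    Occurrence σ j₁ j₂ j₃ j₄
  Occurrence-insertMax⁻ (l₁₂ , l₂₃ , l₃₄ , v₁₂ , v₄₂) =
    punchIn-cancel-< q l₁₂ , punchIn-cancel-< q l₂₃ , punchIn-cancel-< q l₃₄ ,
    insertMax-cancel-< q σ v₁₂ , insertMax-cancel-< q σ v₄₂

  Contains-insertMax⁺ : Contains σ → Contains (insertMax q σ)
  Contains-insertMax⁺ (_ , _ , _ , _ , o) = _ , _ , _ , _ , Occurrence-insertMax⁺ o

  -- The maximum is never label 1 or 4, since those lie below label 2.
  occurrence-insertMax : ∀ {i₁ i₂ i₃ i₄} → Occurrence (insertMax q σ) i₁ i₂ i₃ i₄ →
    q ≡ i₂ ⊎ q ≡ i₃ ⊎ Contains σ
  occurrence-insertMax {i₁} {i₂} {i₃} {i₄} o@(_ , _ , _ , v₁₂ , v₄₂)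
    with punchInView q i₁ | punchInView q i₂ | punchInView q i₃ | punchInView q i₄
  ... | at | _ | _ | _ = ⊥-elim (insertMax-≮-max q σ i₂ v₁₂)
  ... | _ | _ | _ | at = ⊥-elim (insertMax-≮-max q σ i₂ v₄₂)
  ... | _ | at | _ | _ = inj₁ refl
  ... | _ | _ | at | _ = inj₂ (inj₁ refl)
  ... | punch _ | punch _ | punch _ | punch _ = inj₂ (inj₂ (_ , _ , _ , _ , Occurrence-insertMax⁻ o))

Contains-insertMax-zero⁻ : (σ : Vec (Fin n) n) → Contains (insertMax zero σ) → Contains σ
Contains-insertMax-zero⁻ σ (i₁ , i₂ , i₃ , i₄ , o@(l₁₂ , l₂₃ , _))
  with occurrence-insertMax zero σ o
... | inj₁ refl = ⊥-elim (ℕ.n≮0 l₁₂)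
... | inj₂ (inj₁ refl) = ⊥-elim (ℕ.n≮0 (<-trans l₁₂ l₂₃))
... | inj₂ (inj₂ c) = c

Contains-insertMax-last⁻ : (σ : Vec (Fin n) n) → Contains (insertMax (fromℕ n) σ) → Contains σ
Contains-insertMax-last⁻ σ (i₁ , i₂ , i₃ , i₄ , o@(_ , l₂₃ , l₃₄ , _))
  with occurrence-insertMax (fromℕ _) σ o
... | inj₁ refl = ⊥-elim (fromℕ≮ i₃ l₂₃)
... | inj₂ (inj₁ refl) = ⊥-elim (fromℕ≮ i₄ l₃₄)
... | inj₂ (inj₂ c) = c

Contains-insertMax-inner : ∀ {J} (σ : Vec (Fin (suc (suc J))) (suc (suc J))) (j : Fin J) →
  Contains (insertMax (suc (inject₁ (inject₁ j))) σ)
Contains-insertMax-inner σ j =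
  zero , q , suc (suc (inject₁ j)) , suc (suc (suc j)) ,
  z<s , l₂₃ , l₃₄ , insertMax-<-max q σ (λ ()) , insertMax-<-max q σ (<⇒≢ (<-trans l₂₃ l₃₄))
  where
  q = suc (inject₁ (inject₁ j))
  l₂₃ : q < suc (suc (inject₁ j))
  l₂₃ = s<s (≤̄⇒inject₁< ≤-refl)
  l₃₄ : suc (suc (inject₁ j)) < suc (suc (suc j))
  l₃₄ = s<s (s<s (≤̄⇒inject₁< ≤-refl))

-- Peaks before the last entry

PeakBeforeLast : Vec (Fin m) (suc n) → Set
PeakBeforeLast {n = n} σ = ∃ λ i → ∃ λ j →
  i < j × j < fromℕ n × lookup σ i < lookup σ j × lookup σ (fromℕ n) < lookup σ j

peakBeforeLast? : Decidable (PeakBeforeLast {m} {n})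
peakBeforeLast? {n = n} σ = any? λ i → any? λ j →
  (i <? j) ×-dec (j <? fromℕ n) ×-dec (lookup σ i <? lookup σ j) ×-dec (lookup σ (fromℕ n) <? lookup σ j)

module _ (σ : Vec (Fin m) (suc n)) where

  peakBeforeLast-insertMax-zero⁻ : PeakBeforeLast (insertMax zero σ) → PeakBeforeLast σ
  peakBeforeLast-insertMax-zero⁻ (zero , j , _ , _ , v , _) = ⊥-elim (insertMax-≮-max zero σ j v)
  peakBeforeLast-insertMax-zero⁻ (suc i , suc j , l , l′ , v , v′) =
    i , j , punchIn-cancel-< zero l , punchIn-cancel-< zero l′ ,
    insertMax-cancel-< zero σ v , insertMax-cancel-< zero σ v′

  peakBeforeLast-insertMax-zero⁺ : PeakBeforeLast σ → PeakBeforeLast (insertMax zero σ)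
  peakBeforeLast-insertMax-zero⁺ (i , j , l , l′ , v , v′) =
    suc i , suc j , punchIn-mono-< zero l , punchIn-mono-< zero l′ ,
    insertMax-mono-< zero σ v , insertMax-mono-< zero σ v′

  ¬peakBeforeLast-insertMax-last : ¬ PeakBeforeLast (insertMax (fromℕ (suc n)) σ)
  ¬peakBeforeLast-insertMax-last (_ , j , _ , _ , _ , v′) = insertMax-≮-max (fromℕ (suc n)) σ j v′

peakBeforeLast-insertMax-secondLast : (σ : Vec (Fin m) (suc (suc n))) → PeakBeforeLast (insertMax secondLast σ)
peakBeforeLast-insertMax-secondLast σ =
  zero , secondLast , z<s , inject₁<fromℕ _ ,
  insertMax-<-max secondLast σ (λ ()) , insertMax-<-max secondLast σ (fromℕ≢inject₁ ∘ sym)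

module _ (σ : Vec (Fin (suc n)) (suc n)) where

  private
    π = insertMax secondLast σ

  Contains-insertMax-secondLast⁺ : PeakBeforeLast σ → Contains π
  Contains-insertMax-secondLast⁺ (j₁ , j₂ , l₁₂ , l₂ , v₁₂ , v) =
    punchIn secondLast j₁ , punchIn secondLast j₂ , secondLast , fromℕ (suc n) ,
    punchIn-mono-< secondLast l₁₂ , punchIn-inject₁-< l₂ , inject₁<fromℕ (fromℕ n) ,
    insertMax-mono-< secondLast σ v₁₂ ,
    subst (λ i → lookup π i < lookup π (punchIn secondLast j₂)) punchIn-secondLast-fromℕ
      (insertMax-mono-< secondLast σ v)

  -- With the maximum as label 3, label 4 is the last entry.
  peakBeforeLast-of-occurrence : ∀ {i₁ i₂ i₄} → Occurrence π i₁ i₂ secondLast i₄ → PeakBeforeLast σ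
  peakBeforeLast-of-occurrence {i₁} {i₂} {i₄} (l₁₂ , l₂₃ , l₃₄ , v₁₂ , v₄₂)
    with punchInView secondLast i₁ | punchInView secondLast i₂ | secondLast<⇒≡fromℕ i₄ l₃₄
  ... | at | _ | _ = ⊥-elim (insertMax-≮-max secondLast σ i₂ v₁₂)
  ... | _ | at | _ = ⊥-elim (<-irrefl refl l₂₃)
  ... | punch j₁ | punch j₂ | refl =
    j₁ , j₂ , punchIn-cancel-< secondLast l₁₂ ,
    punchIn-cancel-< secondLast (subst (punchIn secondLast j₂ <_) last≡ (<-trans l₂₃ l₃₄)) ,
    insertMax-cancel-< secondLast σ v₁₂ ,
    insertMax-cancel-< secondLast σ
      (subst (λ i → lookup π i < lookup π (punchIn secondLast j₂)) last≡ v₄₂)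
    where
    last≡ = sym punchIn-secondLast-fromℕ

  Contains-insertMax-secondLast⁻ : Contains π → Contains σ ⊎ PeakBeforeLast σ
  Contains-insertMax-secondLast⁻ (i₁ , i₂ , i₃ , i₄ , o@(_ , l₂₃ , l₃₄ , _))
    with occurrence-insertMax secondLast σ o
  ... | inj₁ refl = ⊥-elim (fromℕ≮ i₄ (subst (_< i₄) (secondLast<⇒≡fromℕ i₃ l₂₃) l₃₄))
  ... | inj₂ (inj₁ refl) = inj₂ (peakBeforeLast-of-occurrence o)
  ... | inj₂ (inj₂ c) = inj₁ c

-- Avoiders by the position of their maximum

Avoider : Pred (Vec (Fin n) n) 0ℓ
Avoider = IsPerm ∩ Avoids

avoider? : Decidable (Avoider {n})
avoider? = isPerm? ∩? ∁? contains?

module _ (q : Fin (suc n)) (σ : Vec (Fin n) n) where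

  Avoider-insertMax⁻ : Avoider (insertMax q σ) → Avoider σ
  Avoider-insertMax⁻ (perm , avoids) = isPerm-insertMax⁻ q σ perm , avoids ∘ Contains-insertMax⁺ q σ

  Avoider-insertMax : (Contains (insertMax q σ) → Contains σ) → Avoider σ → Avoider (insertMax q σ)
  Avoider-insertMax reflect (perm , avoids) = isPerm-insertMax q σ perm , avoids ∘ reflect

Avoider-insertMax-zero : (Avoider ∘ insertMax zero) ≐ Avoider {suc n}
Avoider-insertMax-zero =
  (λ {σ} → Avoider-insertMax⁻ zero σ) , (λ {σ} → Avoider-insertMax zero σ (Contains-insertMax-zero⁻ σ))

Avoider-insertMax-last : (Avoider ∘ insertMax (fromℕ (suc n))) ≐ Avoider {suc n}
Avoider-insertMax-last =
  (λ {σ} → Avoider-insertMax⁻ (fromℕ _) σ) ,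
  (λ {σ} → Avoider-insertMax (fromℕ _) σ (Contains-insertMax-last⁻ σ))

Avoider-insertMax-secondLast : (Avoider ∘ insertMax secondLast) ≐ Avoider {suc n} ∩ ∁ PeakBeforeLast
Avoider-insertMax-secondLast = to , from
  where
  to : ∀ {σ} → Avoider (insertMax secondLast σ) → (Avoider ∩ ∁ PeakBeforeLast) σ
  to {σ} av = Avoider-insertMax⁻ secondLast σ av , proj₂ av ∘ Contains-insertMax-secondLast⁺ σ
  from : ∀ {σ} → (Avoider ∩ ∁ PeakBeforeLast) σ → Avoider (insertMax secondLast σ)
  from {σ} (av , ¬peak) = Avoider-insertMax secondLast σ
    ([ id , (λ peak → contradiction peak ¬peak) ] ∘ Contains-insertMax-secondLast⁻ σ) av

PeakedAvoider-insertMax-zero :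
  ((Avoider ∩ PeakBeforeLast) ∘ insertMax zero) ≐ Avoider {suc (suc n)} ∩ PeakBeforeLast
PeakedAvoider-insertMax-zero =
  (λ {σ} (av , peak) → proj₁ Avoider-insertMax-zero {σ} av , peakBeforeLast-insertMax-zero⁻ σ peak) ,
  (λ {σ} (av , peak) → proj₂ Avoider-insertMax-zero {σ} av , peakBeforeLast-insertMax-zero⁺ σ peak)

PeakedAvoider-insertMax-secondLast :
  ((Avoider ∩ PeakBeforeLast) ∘ insertMax secondLast) ≐ Avoider {suc (suc n)} ∩ ∁ PeakBeforeLast
PeakedAvoider-insertMax-secondLast =
  (λ {σ} (av , _) → proj₁ Avoider-insertMax-secondLast {σ} av) ,
  (λ {σ} av → proj₂ Avoider-insertMax-secondLast {σ} av , peakBeforeLast-insertMax-secondLast σ)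

¬PeakedAvoider-insertMax-last : ∀ σ → ¬ (Avoider ∩ PeakBeforeLast) (insertMax (fromℕ (suc (suc n))) σ)
¬PeakedAvoider-insertMax-last σ = ¬peakBeforeLast-insertMax-last σ ∘ proj₂

module _ {J : ℕ} {P : Pred (Vec (Fin (suc (suc (suc J)))) (suc (suc (suc J)))) ℓ} (P? : Decidable P)
         (P⊆Avoider : P ⊆ Avoider) where

  Satisfying-by-maxPosition↔ : Satisfying P? ↔
    (Satisfying (P? ∘ insertMax zero) ⊎
     Satisfying (P? ∘ insertMax secondLast) ⊎
     Satisfying (P? ∘ insertMax (fromℕ (suc (suc J)))))
  Satisfying-by-maxPosition↔ =
    ↔-trans (Satisfying-insertMax↔ P? (proj₁ ∘ P⊆Avoider)) (Σ-Fin-ends↔ _ inner-empty)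
    where
    inner-empty : ∀ j → ¬ Satisfying (P? ∘ insertMax (suc (inject₁ (inject₁ j))))
    inner-empty j (σ , t) = proj₂ (P⊆Avoider (toWitness t)) (Contains-insertMax-inner σ j)

unpeaked? : Decidable (Avoider {suc n} ∩ ∁ PeakBeforeLast)
unpeaked? = avoider? ∩? ∁? peakBeforeLast?

peaked? : Decidable (Avoider {suc n} ∩ PeakBeforeLast)
peaked? = avoider? ∩? peakBeforeLast?

-- unpeaked n and peaked n count avoiders of length suc n.
unpeaked peaked : ℕ → ℕ
unpeaked n = # (unpeaked? {n})
peaked n = # (peaked? {n})

a≡unpeaked+peaked : ∀ n → a (suc n) ≡ unpeaked n + peaked n
a≡unpeaked+peaked n = length-filter-split avoider? peakBeforeLast? (allVecs (suc n) (suc n))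

a-suc : ∀ n → a (3 + n) ≡ a (2 + n) + (unpeaked (1 + n) + a (2 + n))
a-suc n = ↔⇒≡ (
  ↔-trans (↔-sym (Satisfying↔Fin# (avoider? {3 + n}))) (
  ↔-trans (Satisfying-by-maxPosition↔ avoider? id) (
  ⊎-Fin↔ (Satisfying≐↔Fin# (avoider? ∘ insertMax zero) avoider? Avoider-insertMax-zero) (
  ⊎-Fin↔ (Satisfying≐↔Fin# (avoider? ∘ insertMax secondLast) unpeaked? Avoider-insertMax-secondLast)
         (Satisfying≐↔Fin# (avoider? ∘ insertMax (fromℕ (2 + n))) avoider? Avoider-insertMax-last)))))

peaked-suc : ∀ n → peaked (2 + n) ≡ peaked (1 + n) + (unpeaked (1 + n) + 0)
peaked-suc n = ↔⇒≡ (
  ↔-trans (↔-sym (Satisfying↔Fin# (peaked? {2 + n}))) (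
  ↔-trans (Satisfying-by-maxPosition↔ peaked? proj₁) (
  ⊎-Fin↔ (Satisfying≐↔Fin# (peaked? ∘ insertMax zero) peaked? PeakedAvoider-insertMax-zero) (
  ⊎-Fin↔ (Satisfying≐↔Fin# (peaked? ∘ insertMax secondLast) unpeaked? PeakedAvoider-insertMax-secondLast)
         (Satisfying-∅↔ ¬PeakedAvoider-insertMax-last)))))

eliminate-unpeaked-peaked : ∀ {a₄ a₃ a₂ c₃} b₃ b₂ c₂ →
  a₄ ≡ a₃ + (b₃ + a₃) → c₃ ≡ c₂ + (b₂ + 0) → a₃ ≡ b₃ + c₃ → a₂ ≡ b₂ + c₂ →
  a₄ + a₂ ≡ 3 * a₃
eliminate-unpeaked-peaked b₃ b₂ c₂ refl refl refl refl =
  solve (b₃ List.∷ b₂ List.∷ c₂ List.∷ List.[])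

a-recurrence : ∀ n → a (4 + n) + a (2 + n) ≡ 3 * a (3 + n)
a-recurrence n = eliminate-unpeaked-peaked (unpeaked (2 + n)) (unpeaked (1 + n)) (peaked (1 + n))
  (a-suc (suc n)) (peaked-suc n) (a≡unpeaked+peaked (2 + n)) (a≡unpeaked+peaked (1 + n))

-- The generating function

sumTo-vanishing : ∀ k (f : ℕ → ℤ) → (∀ i → f (3 + i) ≡ + 0) → sumTo (2 + k) f ≡ sumTo 2 f
sumTo-vanishing zero f f≡0 = refl
sumTo-vanishing (suc k) f f≡0 = trans (cong₂ _+ℤ_ (sumTo-vanishing k f f≡0) (f≡0 k)) (+ℤ-identityʳ _)

den·-coefficient : ∀ (f : PS) k →
  (den · f) (2 + k) ≡ (+ 1 *ℤ f (2 + k) +ℤ -[1+ 2 ] *ℤ f (1 + k)) +ℤ + 1 *ℤ f k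
den·-coefficient f k = sumTo-vanishing k (λ i → den i *ℤ f ((2 + k) ∸' i)) (λ _ → refl)

three-term-vanishes : ∀ x y z → x + z ≡ 3 * y → (+ 1 *ℤ + x +ℤ -[1+ 2 ] *ℤ + y) +ℤ + 1 *ℤ + z ≡ + 0
three-term-vanishes x y z x+z≡3y = begin
  (+ 1 *ℤ + x +ℤ -[1+ 2 ] *ℤ + y) +ℤ + 1 *ℤ + z ≡⟨ regroup (+ x) (+ y) (+ z) ⟩
  (+ x +ℤ + z) - + 3 *ℤ + y                     ≡⟨ cong₂ _-_ (sym (pos-+ x z)) (sym (pos-* 3 y)) ⟩
  + (x + z) - + (3 * y)                         ≡⟨ cong (λ w → + w - + (3 * y)) x+z≡3y ⟩
  + (3 * y) - + (3 * y)                         ≡⟨ +-inverseʳ (+ (3 * y)) ⟩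
  + 0                                           ∎
  where
  open ≡-Reasoning
  regroup : ∀ X Y Z → (+ 1 *ℤ X +ℤ -[1+ 2 ] *ℤ Y) +ℤ + 1 *ℤ Z ≡ (X +ℤ Z) - + 3 *ℤ Y
  regroup = solve-∀

generating-function : ∀ n → (den · A) n ≡ num n
generating-function 0 = refl
generating-function 1 = refl
generating-function 2 = refl
generating-function 3 = refl
generating-function (suc (suc (suc (suc n)))) =
  trans (den·-coefficient A (2 + n)) (three-term-vanishes (a (4 + n)) (a (3 + n)) (a (2 + n)) (a-recurrence n))

theorem20 : (a 0 ≡ 1) × (a 1 ≡ 1) × (a 2 ≡ 2) × (a 3 ≡ 6)
    × (∀ (n : ℕ) → a (n + 4) + a (n + 2) ≡ 3 * a (n + 3))
    × (∀ (n : ℕ) → (den · A) n ≡ num n)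
theorem20 = refl , refl , refl , refl , recurrence , generating-function
  where
  recurrence : ∀ n → a (n + 4) + a (n + 2) ≡ 3 * a (n + 3)
  recurrence n = begin
    a (n + 4) + a (n + 2) ≡⟨ cong₂ (λ i j → a i + a j) (ℕ.+-comm n 4) (ℕ.+-comm n 2) ⟩
    a (4 + n) + a (2 + n) ≡⟨ a-recurrence n ⟩
    3 * a (3 + n)         ≡⟨ cong (λ i → 3 * a i) (ℕ.+-comm 3 n) ⟩
    3 * a (n + 3)         ∎
    where open ≡-Reasoning
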